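{- Let $H$ be the complement of the $5$-cycle, or the complement of the Petersen graph, or the complement of the Hoffman–Singleton graph, or the complement of a (hypothetical) $57$-regular graph with girth $5$. Then every inflation $G$ of $H$ that is connected and has $\alpha(G)=2$ has a non-empty connected dominating matching.
   Context: All graphs are finite and simple. An inflation of a graph $H$ is obtained by choosing integers $c_x\ge 0$ for $x\in V(H)$, replacing each $x$ by a clique $C_x$ of order $c_x$, with every vertex of $C_x$ adjacent to every vertex of $C_y$ ($x\neq y$) if $xy\in E(H)$ and no edges between them otherwise. A matching $M$ is connected if for any two edges $e,f\in M$ some endpoint of $e$ is adjacent to some endpoint of $f$; it is dominating if every vertex not covered by $M$ is adjacent to at least one endpoint of each edge of $M$. The Hoffman–Singleton graph is the unique $7$-regular graph on $50$ vertices with diameter $2$ and girth $5$. -}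

module Defs where

open import Data.Nat using (ℕ; zero; suc; _+_; _∸_; _%_; _≡ᵇ_; _<ᵇ_; _≤ᵇ_; _≥_)
open import Data.Fin using (Fin; toℕ; inject₁; fromℕ; _≟_) renaming (zero to fzero; suc to fsuc)
open import Data.Bool using (Bool; true; false; not; _∧_; _∨_; if_then_else_; T)
open import Data.Bool.Properties using (∨-comm)
open import Data.List using (List; map; allFin)
open import Data.Nat.ListAction using (sum)
open import Data.Product using (Σ; ∃; _×_; _,_)
open import Data.Sum using (_⊎_; inj₁; inj₂)
open import Data.Empty using (⊥; ⊥-elim)
open import Relation.Nullary using (¬_; yes; no)
open import Relation.Nullary.Decidable using (⌊_⌋)
open import Relation.Binary.PropositionalEquality using (_≡_; _≢_; refl; sym; subst; cong₂)
open import Function.Definitions using (Injective)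
open import Function.Bundles using (_↔_; Inverse)

record Graph : Set₁ where
  field
    V        : Set
    _~_      : V → V → Set
    ~-sym    : ∀ {u v} → u ~ v → v ~ u
    ~-irrefl : ∀ {v} → ¬ (v ~ v)

record SimpleGraph (n : ℕ) : Set where
  field
    adj        : Fin n → Fin n → Bool
    adj-sym    : ∀ u v → adj u v ≡ adj v u
    adj-irrefl : ∀ v → adj v v ≡ false

open SimpleGraph public

Adj : ∀ {n} → SimpleGraph n → Fin n → Fin n → Set
Adj F u v = T (adj F u v)

private
  eqb-sym : ∀ {n} (u v : Fin n) → ⌊ u ≟ v ⌋ ≡ ⌊ v ≟ u ⌋
  eqb-sym u v with u ≟ v | v ≟ u
  ... | yes _ | yes _ = refl
  ... | no _  | no _  = refl
  ... | yes p | no q  = ⊥-elim (q (sym p))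
  ... | no p  | yes q = ⊥-elim (p (sym q))

  eqb-refl : ∀ {n} (v : Fin n) → ⌊ v ≟ v ⌋ ≡ true
  eqb-refl v with v ≟ v
  ... | yes _ = refl
  ... | no p  = ⊥-elim (p refl)

  T-false : ∀ {b} → b ≡ false → ¬ T b
  T-false refl ()

toGraph : ∀ {n} → SimpleGraph n → Graph
toGraph {n} F = record
  { V = Fin n
  ; _~_ = Adj F
  ; ~-sym = λ {u} {v} p → subst T (adj-sym F u v) p
  ; ~-irrefl = λ {v} → T-false (adj-irrefl F v)
  }

mkGraph : ∀ {n} → (Fin n → Fin n → Bool) → SimpleGraph n
mkGraph r = record
  { adj = λ u v → not ⌊ u ≟ v ⌋ ∧ (r u v ∨ r v u)
  ; adj-sym = λ u v → cong₂ (λ a b → not a ∧ b) (eqb-sym u v) (∨-comm (r u v) (r v u))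
  ; adj-irrefl = λ v → subst (λ b → not b ∧ (r v v ∨ r v v) ≡ false) (sym (eqb-refl v)) refl
  }

complement : ∀ {n} → SimpleGraph n → SimpleGraph n
complement F = record
  { adj = λ u v → not ⌊ u ≟ v ⌋ ∧ not (adj F u v)
  ; adj-sym = λ u v → cong₂ (λ a b → not a ∧ not b) (eqb-sym u v) (adj-sym F u v)
  ; adj-irrefl = λ v → subst (λ b → not b ∧ not (adj F v v) ≡ false) (sym (eqb-refl v)) refl
  }

record _≅_ {n m : ℕ} (F : SimpleGraph n) (F' : SimpleGraph m) : Set where
  field
    bij      : Fin n ↔ Fin m
    preserve : ∀ u v → adj F u v ≡ adj F' (Inverse.to bij u) (Inverse.to bij v)

C5 : SimpleGraph 5
C5 = mkGraph (λ u v → (suc (toℕ u) % 5) ≡ᵇ toℕ v)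

-- The Petersen graph: outer 5-cycle on 0..4 (i ~ i+1 mod 5), inner pentagram
-- on 5..9 (5+i ~ 5+(i+2 mod 5)), spokes i ~ 5+i.
petersenRel : Fin 10 → Fin 10 → Bool
petersenRel u v =
  ((a <ᵇ 5) ∧ (b <ᵇ 5) ∧ ((suc a % 5) ≡ᵇ b))
  ∨ ((5 ≤ᵇ a) ∧ (5 ≤ᵇ b) ∧ ((((a ∸ 5) + 2) % 5) ≡ᵇ (b ∸ 5)))
  ∨ ((a + 5) ≡ᵇ b)
  where
    a = toℕ u
    b = toℕ v

Petersen : SimpleGraph 10
Petersen = mkGraph petersenRel

degree : ∀ {n} → SimpleGraph n → Fin n → ℕ
degree {n} F v = sum (map (λ w → if adj F v w then 1 else 0) (allFin n))

Regular : ∀ {n} → ℕ → SimpleGraph n → Set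
Regular d F = ∀ v → degree F v ≡ d

-- A cycle with suc m vertices: an injective closed walk f 0 ~ f 1 ~ … ~ f m ~ f 0.
record CycleWith {n} (F : SimpleGraph n) (m : ℕ) : Set where
  field
    f     : Fin (suc m) → Fin n
    inj   : Injective _≡_ _≡_ f
    step  : ∀ (i : Fin m) → Adj F (f (inject₁ i)) (f (fsuc i))
    close : Adj F (f (fromℕ m)) (f fzero)

Girth5 : ∀ {n} → SimpleGraph n → Set
Girth5 F = ¬ CycleWith F 2 × ¬ CycleWith F 3 × CycleWith F 4

Diameter2 : ∀ {n} → SimpleGraph n → Set
Diameter2 {n} F =
  (∀ u v → u ≢ v → Adj F u v ⊎ Σ (Fin n) (λ w → Adj F u w × Adj F w v))
  × Σ (Fin n) (λ u → Σ (Fin n) (λ v → u ≢ v × ¬ Adj F u v))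

-- The graphs F whose complements are considered in Corollary 3.2.
-- (Hoffman–Singleton: the 7-regular graph on 50 vertices with diameter 2
-- and girth 5; the last case: a 57-regular graph of girth 5 and diameter 2,
-- i.e. the hypothetical Moore graph.)
IsTarget : ∀ {n} → SimpleGraph n → Set
IsTarget {n} F =
  (F ≅ C5)
  ⊎ (F ≅ Petersen)
  ⊎ (n ≡ 50 × Regular 7 F × Diameter2 F × Girth5 F)
  ⊎ (Regular 57 F × Diameter2 F × Girth5 F)

module _ (H : Graph) where
  open Graph H

  Inflation : (V → ℕ) → Graph
  Inflation c = record
    { V = Σ V (λ x → Fin (c x))
    ; _~_ = InfAdj
    ; ~-sym = isym
    ; ~-irrefl = iirr
    }
    where
      InfAdj : Σ V (λ x → Fin (c x)) → Σ V (λ x → Fin (c x)) → Set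
      InfAdj (x , i) (y , j) = (x ≡ y × (x , i) ≢ (y , j)) ⊎ (x ~ y)
      isym : ∀ {p q} → InfAdj p q → InfAdj q p
      isym (inj₁ (e , ne)) = inj₁ (sym e , λ q → ne (sym q))
      isym (inj₂ a) = inj₂ (~-sym a)
      iirr : ∀ {p} → ¬ InfAdj p p
      iirr (inj₁ (_ , ne)) = ne refl
      iirr (inj₂ a) = ~-irrefl a

module _ (G : Graph) where
  open Graph G

  data Reach (u : V) : V → Set where
    here : Reach u u
    next : ∀ {v w} → Reach u v → v ~ w → Reach u w

  Connected : Set
  Connected = ∀ u v → Reach u v

  record IndepSet (k : ℕ) : Set where
    field
      f     : Fin k → V
      inj   : Injective _≡_ _≡_ f
      indep : ∀ i j → ¬ (f i ~ f j)

  IndependenceNumber2 : Set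
  IndependenceNumber2 = IndepSet 2 × ¬ IndepSet 3

  record Matching : Set where
    field
      k        : ℕ
      a b      : Fin k → V
      edge     : ∀ i → a i ~ b i
      disj-aa  : ∀ i j → i ≢ j → a i ≢ a j
      disj-ab  : ∀ i j → i ≢ j → a i ≢ b j
      disj-bb  : ∀ i j → i ≢ j → b i ≢ b j

    Covered : V → Set
    Covered v = Σ (Fin k) (λ i → v ≡ a i ⊎ v ≡ b i)

    NonEmpty : Set
    NonEmpty = k ≥ 1

    IsConnectedMatching : Set
    IsConnectedMatching = ∀ i j → i ≢ j →
      (a i ~ a j) ⊎ (a i ~ b j) ⊎ (b i ~ a j) ⊎ (b i ~ b j)

    IsDominating : Set
    IsDominating = ∀ v → ¬ Covered v → ∀ i → (v ~ a i) ⊎ (v ~ b i)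

  HasNonEmptyConnectedDominatingMatching : Set
  HasNonEmptyConnectedDominatingMatching =
    Σ Matching (λ M → Matching.NonEmpty M × Matching.IsConnectedMatching M × Matching.IsDominating M)

{-# OPTIONS --safe #-}
-- Only two consequences of the hypotheses are used: F has no triangle and no 4-cycle, and G has
-- vertices in two different bags. Call x occupied
-- if its bag is nonempty. If some H-edge xy between occupied bags has no occupied common
-- F-neighbour, a single edge between the two bags dominates. Otherwise every occupied x has two
-- occupied F-neighbours: connectivity gives an occupied H-neighbour y, whence a common
-- F-neighbour t, and an occupied H-neighbour of t yields a second one. Take an occupied p with
-- smallest bag, its occupied F-neighbour q with smallest bag, and occupied F-neighbours w₂ ≠ q
-- of p and w₁ ≠ p of q. Match the bag of p into the bag of w₁ and the bag of q into that of w₂.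
-- As F has no triangle and no 4-cycle, pw₁, qw₂ and w₁w₂ are H-edges, and a vertex F-adjacent
-- to both ends of one matching edge would close a 4-cycle through p and q.

module Submission where

open import Defs
open import Data.Nat using (ℕ; _≤_; _<_; _+_; zero; suc; z≤n; s≤s; s≤s⁻¹)
open import Data.Nat.Properties using (_<?_; ≤-trans; <-≤-trans; ≤-refl; ≮⇒≥; m≤m+n)
open import Data.Fin using (Fin; _≟_; fromℕ<; inject≤; inject₁; splitAt; join)
  renaming (suc to fsuc)
open import Data.Fin.Patterns using (0F; 1F; 2F; 3F)
open import Data.Fin.Properties using (all?; any?; toℕ<n; inject≤-injective; splitAt-join; +↔⊎)
open import Data.Bool using (T; true; false)
open import Data.Product using (∃-syntax; _×_; _,_; proj₁; proj₂)
open import Data.Sum using (_⊎_; inj₁; inj₂)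
open import Function using (_∘_; _∋_; const)
open import Function.Bundles using (Bijection)
open import Function.Definitions using (Injective)
open import Function.Properties.Inverse using (↔⇒⤖)
open import Relation.Nullary using (¬_; Dec; yes; no; contradiction)
open import Relation.Nullary.Decidable
  using (_×-dec_; _→-dec_; ¬?; T?; toSum; toWitness; decidable-stable)
open import Relation.Unary using (Decidable)
open import Relation.Binary.PropositionalEquality using (_≡_; _≢_; refl; sym; cong; subst; ≢-sym)

private
  variable
    n m : ℕ

module _ (F : SimpleGraph n) where

  Adj-sym : ∀ {x y} → Adj F x y → Adj F y x
  Adj-sym {x} {y} = subst T (adj-sym F x y)

  Adj-irrefl : ∀ {x y} → Adj F x y → x ≢ y
  Adj-irrefl {x} xx refl = subst T (adj-irrefl F x) xx

Adj? : (F : SimpleGraph n) → ∀ x y → Dec (Adj F x y)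
Adj? F x y = T? (adj F x y)

complement-adj⁺ : (F : SimpleGraph n) → ∀ {x y} → x ≢ y → ¬ Adj F x y → Adj (complement F) x y
complement-adj⁺ F {x} {y} x≢y ¬xy with x ≟ y | adj F x y
... | yes x≡y | _     = x≢y x≡y
... | no _    | true  = ¬xy _
... | no _    | false = _

complement-adj⁻ : (F : SimpleGraph n) → ∀ {x y} → Adj (complement F) x y → x ≢ y × ¬ Adj F x y
complement-adj⁻ F {x} {y} h with x ≟ y | adj F x y
... | no x≢y | false = x≢y , λ ()

TriangleFree : SimpleGraph n → Set
TriangleFree F = ∀ a b c → ¬ (Adj F a b × Adj F b c × Adj F c a)

SquareFree : SimpleGraph n → Set
SquareFree F = ∀ a b c d → a ≢ c → b ≢ d → ¬ (Adj F a b × Adj F b c × Adj F c d × Adj F d a)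

Girth≥5 : SimpleGraph n → Set
Girth≥5 F = TriangleFree F × SquareFree F

triangleFree? : (F : SimpleGraph n) → Dec (TriangleFree F)
triangleFree? F = all? λ a → all? λ b → all? λ c →
  ¬? (Adj? F a b ×-dec Adj? F b c ×-dec Adj? F c a)

squareFree? : (F : SimpleGraph n) → Dec (SquareFree F)
squareFree? F = all? λ a → all? λ b → all? λ c → all? λ d →
  ¬? (a ≟ c) →-dec ¬? (b ≟ d) →-dec
  ¬? (Adj? F a b ×-dec Adj? F b c ×-dec Adj? F c d ×-dec Adj? F d a)

girth≥5-C5 : Girth≥5 C5
girth≥5-C5 = toWitness {a? = triangleFree? C5} _ , toWitness {a? = squareFree? C5} _

girth≥5-Petersen : Girth≥5 Petersen
girth≥5-Petersen =
  toWitness {a? = triangleFree? Petersen} _ , toWitness {a? = squareFree? Petersen} _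

module _ {F : SimpleGraph n} where

  triangle⇒3-cycle : ∀ {a b c} → Adj F a b → Adj F b c → Adj F c a → CycleWith F 2
  triangle⇒3-cycle {a} {b} {c} ab bc ca = record { f = f ; inj = inj ; step = step ; close = ca }
    where
    f : Fin 3 → Fin n
    f 0F = a
    f 1F = b
    f 2F = c

    inj : Injective _≡_ _≡_ f
    inj {0F} {0F} _ = refl
    inj {0F} {1F} e = contradiction e (Adj-irrefl F ab)
    inj {0F} {2F} e = contradiction (sym e) (Adj-irrefl F ca)
    inj {1F} {0F} e = contradiction (sym e) (Adj-irrefl F ab)
    inj {1F} {1F} _ = refl
    inj {1F} {2F} e = contradiction e (Adj-irrefl F bc)
    inj {2F} {0F} e = contradiction e (Adj-irrefl F ca)
    inj {2F} {1F} e = contradiction (sym e) (Adj-irrefl F bc)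
    inj {2F} {2F} _ = refl

    step : ∀ i → Adj F (f (inject₁ i)) (f (fsuc i))
    step 0F = ab
    step 1F = bc

  square⇒4-cycle : ∀ {a b c d} → a ≢ c → b ≢ d →
                   Adj F a b → Adj F b c → Adj F c d → Adj F d a → CycleWith F 3
  square⇒4-cycle {a} {b} {c} {d} a≢c b≢d ab bc cd da =
    record { f = f ; inj = inj ; step = step ; close = da }
    where
    f : Fin 4 → Fin n
    f 0F = a
    f 1F = b
    f 2F = c
    f 3F = d

    inj : Injective _≡_ _≡_ f
    inj {0F} {0F} _ = refl
    inj {0F} {1F} e = contradiction e (Adj-irrefl F ab)
    inj {0F} {2F} e = contradiction e a≢c
    inj {0F} {3F} e = contradiction (sym e) (Adj-irrefl F da)
    inj {1F} {0F} e = contradiction (sym e) (Adj-irrefl F ab)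
    inj {1F} {1F} _ = refl
    inj {1F} {2F} e = contradiction e (Adj-irrefl F bc)
    inj {1F} {3F} e = contradiction e b≢d
    inj {2F} {0F} e = contradiction (sym e) a≢c
    inj {2F} {1F} e = contradiction (sym e) (Adj-irrefl F bc)
    inj {2F} {2F} _ = refl
    inj {2F} {3F} e = contradiction e (Adj-irrefl F cd)
    inj {3F} {0F} e = contradiction e (Adj-irrefl F da)
    inj {3F} {1F} e = contradiction (sym e) b≢d
    inj {3F} {2F} e = contradiction (sym e) (Adj-irrefl F cd)
    inj {3F} {3F} _ = refl

    step : ∀ i → Adj F (f (inject₁ i)) (f (fsuc i))
    step 0F = ab
    step 1F = bc
    step 2F = cd

  girth5⇒girth≥5 : Girth5 F → Girth≥5 F
  girth5⇒girth≥5 (¬3-cycle , ¬4-cycle , _) =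
    (λ a b c (ab , bc , ca) → ¬3-cycle (triangle⇒3-cycle ab bc ca)) ,
    (λ a b c d a≢c b≢d (ab , bc , cd , da) → ¬4-cycle (square⇒4-cycle a≢c b≢d ab bc cd da))

girth≥5-≅ : {F : SimpleGraph n} {F′ : SimpleGraph m} → F ≅ F′ → Girth≥5 F′ → Girth≥5 F
girth≥5-≅ {F = F} {F′} iso (triangleFree , squareFree) =
  (λ a b c (ab , bc , ca) → triangleFree (to a) (to b) (to c) (map ab , map bc , map ca)) ,
  (λ a b c d a≢c b≢d (ab , bc , cd , da) →
    squareFree (to a) (to b) (to c) (to d) (a≢c ∘ injective) (b≢d ∘ injective)
               (map ab , map bc , map cd , map da))
  where
  open _≅_ iso
  open Bijection (↔⇒⤖ bij) using (to; injective)

  map : ∀ {x y} → Adj F x y → Adj F′ (to x) (to y)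
  map {x} {y} = subst T (preserve x y)

isTarget⇒girth≥5 : {F : SimpleGraph n} → IsTarget F → Girth≥5 F
isTarget⇒girth≥5 (inj₁ F≅C5)                       = girth≥5-≅ F≅C5 girth≥5-C5
isTarget⇒girth≥5 (inj₂ (inj₁ F≅Petersen))          = girth≥5-≅ F≅Petersen girth≥5-Petersen
isTarget⇒girth≥5 (inj₂ (inj₂ (inj₁ (_ , _ , _ , g)))) = girth5⇒girth≥5 g
isTarget⇒girth≥5 (inj₂ (inj₂ (inj₂ (_ , _ , g))))     = girth5⇒girth≥5 g

module _ (G : Graph) where
  open Graph G

  mkMatching : ∀ {k} (a b : Fin k → V) → (∀ i → a i ~ b i) →
               Injective _≡_ _≡_ a → Injective _≡_ _≡_ b → (∀ i j → a i ≢ b j) → Matching G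
  mkMatching a b edge a-injective b-injective a≢b = record
    { a       = a
    ; b       = b
    ; edge    = edge
    ; disj-aa = λ _ _ i≢j → i≢j ∘ a-injective
    ; disj-ab = λ i j _ → a≢b i j
    ; disj-bb = λ _ _ i≢j → i≢j ∘ b-injective
    }

  edgeMatching : ∀ {u v} → u ~ v → Matching G
  edgeMatching {u} {v} u~v =
    mkMatching (const u) (const v) (const u~v) (λ _ → Fin1-unique) (λ _ → Fin1-unique)
               (λ _ _ u≡v → ~-irrefl (subst (u ~_) (sym u≡v) u~v))
    where
    Fin1-unique : {i j : Fin 1} → i ≡ j
    Fin1-unique {0F} {0F} = refl

  edgeMatching-connected : ∀ {u v} (u~v : u ~ v) → Matching.IsConnectedMatching (edgeMatching u~v)
  edgeMatching-connected _ 0F 0F 0≢0 = contradiction refl 0≢0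

module _ {Q : Fin n → Set} (Q? : Decidable Q) (f : Fin n → ℕ) where

  Minimiser : Set
  Minimiser = ∃[ y ] Q y × ∀ z → Q z → f y ≤ f z

  private
    minimiser-below : ∀ k x → Q x → f x ≤ k → Minimiser
    minimiser-below zero x qx fx≤0 = x , qx , λ _ _ → ≤-trans fx≤0 z≤n
    minimiser-below (suc k) x qx fx≤k with any? (λ z → Q? z ×-dec f z <? f x)
    ... | yes (z , qz , fz<fx) = minimiser-below k z qz (s≤s⁻¹ (<-≤-trans fz<fx fx≤k))
    ... | no ∄smaller          = x , qx , λ z qz → ≮⇒≥ (λ fz<fx → ∄smaller (z , qz , fz<fx))

  minimiser : ∃[ x ] Q x → Minimiser
  minimiser (x , qx) = minimiser-below (f x) x qx ≤-refl

module InflatedComplement (F : SimpleGraph n) (c : Fin n → ℕ) where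

  H : SimpleGraph n
  H = complement F

  G : Graph
  G = Inflation (toGraph H) c

  open Graph G using (V; _~_)

  Occupied : Fin n → Set
  Occupied x = 0 < c x

  occupied? : Decidable Occupied
  occupied? x = 0 <? c x

  occupied : ∀ {x} → Fin (c x) → Occupied x
  occupied i = ≤-trans (s≤s z≤n) (toℕ<n i)

  bag-injective : ∀ {x} {i j : Fin (c x)} → (V ∋ (x , i)) ≡ (x , j) → i ≡ j
  bag-injective refl = refl

  -- toSum rather than a direct with on _≟_, which would also abstract the decision inside Adj H.
  dominates : ∀ {u v w : V} → u ≢ v → u ≢ w →
              ¬ (Adj F (proj₁ u) (proj₁ v) × Adj F (proj₁ u) (proj₁ w)) → u ~ v ⊎ u ~ w
  dominates {u} {v} {w} u≢v u≢w ¬both with toSum (proj₁ u ≟ proj₁ v) | toSum (proj₁ u ≟ proj₁ w)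
  ... | inj₁ same | _         = inj₁ (inj₁ (same , u≢v))
  ... | inj₂ _    | inj₁ same = inj₂ (inj₁ (same , u≢w))
  ... | inj₂ x≢y  | inj₂ x≢z with Adj? F (proj₁ u) (proj₁ v)
  ...   | yes xy = inj₂ (inj₂ (complement-adj⁺ F x≢z λ xz → ¬both (xy , xz)))
  ...   | no ¬xy = inj₁ (inj₂ (complement-adj⁺ F x≢y ¬xy))

  leaveBag : ∀ {x} {u w : V} → Reach G u w → proj₁ u ≡ x → proj₁ w ≢ x →
             ∃[ y ] Occupied y × Adj H x y
  leaveBag here u∈x w∉x = contradiction u∈x w∉x
  leaveBag {x} (next {v} {w} r v~w) u∈x w∉x with proj₁ v ≟ x
  ... | no v∉x = leaveBag r u∈x v∉x
  ... | yes refl with v~w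
  ...   | inj₁ (v≡w , _) = contradiction (sym v≡w) w∉x
  ...   | inj₂ vw        = proj₁ w , occupied (proj₂ w) , vw

  occupiedNeighbour : Connected G → (u v : V) → proj₁ u ≢ proj₁ v →
                      ∀ {x} → Occupied x → ∃[ y ] Occupied y × Adj H x y
  occupiedNeighbour conn u v u≢v {x} ox with proj₁ u ≟ x
  ... | yes refl = leaveBag (conn (x , fromℕ< ox) v) refl (≢-sym u≢v)
  ... | no u∉x   = leaveBag (conn (x , fromℕ< ox) u) refl u∉x

  CommonNeighbour : Fin n → Fin n → Set
  CommonNeighbour x y = ∃[ z ] Occupied z × Adj F z x × Adj F z y

  commonNeighbour? : ∀ x y → Dec (CommonNeighbour x y)
  commonNeighbour? x y = any? λ z → occupied? z ×-dec Adj? F z x ×-dec Adj? F z y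

  DominatingPair : Fin n → Fin n → Set
  DominatingPair x y = Occupied x × Occupied y × Adj H x y × ¬ CommonNeighbour x y

  dominatingPair? : Dec (∃[ x ] ∃[ y ] DominatingPair x y)
  dominatingPair? = any? λ x → any? λ y →
    occupied? x ×-dec occupied? y ×-dec Adj? H x y ×-dec ¬? (commonNeighbour? x y)

  dominatingPair⇒matching : ∀ {x y} → DominatingPair x y → HasNonEmptyConnectedDominatingMatching G
  dominatingPair⇒matching {x} {y} (ox , oy , xy , ¬common) =
    edgeMatching G x₀~y₀ , s≤s z≤n , edgeMatching-connected G x₀~y₀ , dominating
    where
    x₀~y₀ : (x , fromℕ< ox) ~ (y , fromℕ< oy)
    x₀~y₀ = inj₂ xy

    dominating : Matching.IsDominating (edgeMatching G x₀~y₀)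
    dominating (z , l) uncovered i =
      dominates (uncovered ∘ (i ,_) ∘ inj₁) (uncovered ∘ (i ,_) ∘ inj₂)
                (λ (zx , zy) → ¬common (z , occupied l , zx , zy))

  module CrossMatching (triangleFree : TriangleFree F) (squareFree : SquareFree F)
    {p q w₁ w₂ : Fin n} (pq : Adj F p q) (qw₁ : Adj F q w₁) (pw₂ : Adj F p w₂)
    (p≢w₁ : p ≢ w₁) (q≢w₂ : q ≢ w₂) (p≤w₁ : c p ≤ c w₁) (q≤w₂ : c q ≤ c w₂) where

    Edge : Set
    Edge = Fin (c p) ⊎ Fin (c q)

    source : Edge → V
    source (inj₁ i) = p , i
    source (inj₂ j) = q , j

    target : Edge → V
    target (inj₁ i) = w₁ , inject≤ i p≤w₁
    target (inj₂ j) = w₂ , inject≤ j q≤w₂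

    w₁≢w₂ : w₁ ≢ w₂
    w₁≢w₂ refl = triangleFree p q w₁ (pq , qw₁ , Adj-sym F pw₂)

    w₁~w₂ : Adj H w₁ w₂
    w₁~w₂ = complement-adj⁺ F w₁≢w₂ λ w₁w₂ →
      squareFree p q w₁ w₂ p≢w₁ q≢w₂ (pq , qw₁ , w₁w₂ , Adj-sym F pw₂)

    edge : ∀ s → source s ~ target s
    edge (inj₁ _) = inj₂ (complement-adj⁺ F p≢w₁ λ pw₁ →
      triangleFree p q w₁ (pq , qw₁ , Adj-sym F pw₁))
    edge (inj₂ _) = inj₂ (complement-adj⁺ F q≢w₂ λ qw₂ →
      triangleFree p q w₂ (pq , qw₂ , Adj-sym F pw₂))

    source-injective : Injective _≡_ _≡_ source
    source-injective {inj₁ _} {inj₁ _} refl = refl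
    source-injective {inj₁ _} {inj₂ _} e    = contradiction (cong proj₁ e) (Adj-irrefl F pq)
    source-injective {inj₂ _} {inj₁ _} e    = contradiction (cong proj₁ e) (≢-sym (Adj-irrefl F pq))
    source-injective {inj₂ _} {inj₂ _} refl = refl

    target-injective : Injective _≡_ _≡_ target
    target-injective {inj₁ i} {inj₁ j} e = cong inj₁ (inject≤-injective _ _ i j (bag-injective e))
    target-injective {inj₁ _} {inj₂ _} e = contradiction (cong proj₁ e) w₁≢w₂
    target-injective {inj₂ _} {inj₁ _} e = contradiction (cong proj₁ e) (≢-sym w₁≢w₂)
    target-injective {inj₂ i} {inj₂ j} e = cong inj₂ (inject≤-injective _ _ i j (bag-injective e))

    source≢target : ∀ s t → source s ≢ target t
    source≢target (inj₁ _) (inj₁ _) = p≢w₁ ∘ cong proj₁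
    source≢target (inj₁ _) (inj₂ _) = Adj-irrefl F pw₂ ∘ cong proj₁
    source≢target (inj₂ _) (inj₁ _) = Adj-irrefl F qw₁ ∘ cong proj₁
    source≢target (inj₂ _) (inj₂ _) = q≢w₂ ∘ cong proj₁

    split : Fin (c p + c q) → Edge
    split = splitAt (c p)

    split-injective : Injective _≡_ _≡_ split
    split-injective = Bijection.injective (↔⇒⤖ (+↔⊎ {c p} {c q}))

    matching : Matching G
    matching = mkMatching G (source ∘ split) (target ∘ split) (edge ∘ split)
      (split-injective ∘ source-injective) (split-injective ∘ target-injective)
      (λ i j → source≢target (split i) (split j))

    source-covered : ∀ s → Matching.Covered matching (source s)
    source-covered s = join (c p) (c q) s , inj₁ (cong source (sym (splitAt-join (c p) (c q) s)))

    connected : Matching.IsConnectedMatching matching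
    connected i j i≢j = linked (split i) (split j) (i≢j ∘ split-injective)
      where
      linked : ∀ s t → s ≢ t →
               source s ~ source t ⊎ source s ~ target t ⊎ target s ~ source t ⊎ target s ~ target t
      linked (inj₁ _) (inj₁ _) s≢t = inj₁ (inj₁ (refl , s≢t ∘ source-injective))
      linked (inj₁ _) (inj₂ _) _   = inj₂ (inj₂ (inj₂ (inj₂ w₁~w₂)))
      linked (inj₂ _) (inj₁ _) _   = inj₂ (inj₂ (inj₂ (inj₂ (Adj-sym H w₁~w₂))))
      linked (inj₂ _) (inj₂ _) s≢t = inj₁ (inj₁ (refl , s≢t ∘ source-injective))

    ¬adjacentToBoth : ∀ {z} → z ≢ p → z ≢ q → ∀ s →
                   ¬ (Adj F z (proj₁ (source s)) × Adj F z (proj₁ (target s)))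
    ¬adjacentToBoth _ z≢q (inj₁ _) (zp , zw₁) =
      squareFree p q w₁ _ p≢w₁ (≢-sym z≢q) (pq , qw₁ , Adj-sym F zw₁ , zp)
    ¬adjacentToBoth z≢p _ (inj₂ _) (zq , zw₂) =
      squareFree q p w₂ _ q≢w₂ (≢-sym z≢p) (Adj-sym F pq , pw₂ , Adj-sym F zw₂ , zq)

    dominating : Matching.IsDominating matching
    dominating (z , l) uncovered i =
      dominates (uncovered ∘ (i ,_) ∘ inj₁) (uncovered ∘ (i ,_) ∘ inj₂)
                (¬adjacentToBoth z∉p z∉q (split i))
      where
      z∉p : z ≢ p
      z∉p refl = uncovered (source-covered (inj₁ l))

      z∉q : z ≢ q
      z∉q refl = uncovered (source-covered (inj₂ l))

    hasMatching : Occupied p → HasNonEmptyConnectedDominatingMatching G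
    hasMatching op = matching , ≤-trans op (m≤m+n (c p) (c q)) , connected , dominating

  module NoDominatingPair (exit : ∀ {x} → Occupied x → ∃[ y ] Occupied y × Adj H x y)
                          (¬pair : ∀ {x y} → ¬ DominatingPair x y) where

    commonNeighbour : ∀ {x y} → Occupied x → Occupied y → Adj H x y → CommonNeighbour x y
    commonNeighbour {x} {y} ox oy xy =
      decidable-stable (commonNeighbour? x y) λ ¬common → ¬pair (ox , oy , xy , ¬common)

    fNeighbour : ∀ {x} → Occupied x → ∃[ t ] Occupied t × Adj F x t
    fNeighbour ox =
      let (y , oy , xy) = exit ox
          (t , ot , tx , _) = commonNeighbour ox oy xy
      in t , ot , Adj-sym F tx

    anotherFNeighbour : ∀ {x t} → Occupied x → Occupied t → Adj F x t →
                        ∃[ t′ ] Occupied t′ × Adj F x t′ × t′ ≢ t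
    anotherFNeighbour {x} {t} ox ot xt with exit ot
    ... | y , oy , ty with complement-adj⁻ F ty
    ...   | t≢y , ¬ty with Adj? F x y
    ...     | yes xy = y , oy , xy , ≢-sym t≢y
    ...     | no ¬xy =
      let x≢y : x ≢ y
          x≢y x≡y = ¬ty (subst (Adj F t) x≡y (Adj-sym F xt))
          (z , oz , zx , zy) = commonNeighbour ox oy (complement-adj⁺ F x≢y ¬xy)
      in z , oz , Adj-sym F zx , λ z≡t → ¬ty (subst (λ s → Adj F s y) z≡t zy)

    fNeighbourOtherThan : ∀ {x} → Occupied x → ∀ a → ∃[ t ] Occupied t × Adj F x t × t ≢ a
    fNeighbourOtherThan ox a with fNeighbour ox
    ... | t , ot , xt with t ≟ a
    ...   | no t≢a   = t , ot , xt , t≢a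
    ...   | yes refl = anotherFNeighbour ox ot xt

    hasMatching : Girth≥5 F → ∀ {x₀} → Occupied x₀ → HasNonEmptyConnectedDominatingMatching G
    hasMatching (triangleFree , squareFree) ox₀ =
      let (p , op , p-min)        = minimiser occupied? c (_ , ox₀)
          (q , (oq , pq) , q-min) = minimiser (λ y → occupied? y ×-dec Adj? F p y) c (fNeighbour op)
          (w₂ , ow₂ , pw₂ , w₂≢q) = fNeighbourOtherThan op q
          (w₁ , ow₁ , qw₁ , w₁≢p) = fNeighbourOtherThan oq p
      in CrossMatching.hasMatching triangleFree squareFree pq qw₁ pw₂ (≢-sym w₁≢p) (≢-sym w₂≢q)
           (p-min w₁ ow₁) (q-min w₂ (ow₂ , pw₂)) op

  connectedDominatingMatching : Girth≥5 F → Connected G → (u v : V) → proj₁ u ≢ proj₁ v →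
                                HasNonEmptyConnectedDominatingMatching G
  connectedDominatingMatching girth conn u v u≢v with dominatingPair?
  ... | yes (_ , _ , pair) = dominatingPair⇒matching pair
  ... | no ∄pair = NoDominatingPair.hasMatching (occupiedNeighbour conn u v u≢v)
                     (λ pair → ∄pair (_ , _ , pair)) girth (occupied (proj₂ u))

  independent⇒differentBags : (I : IndepSet G 2) →
                              let open IndepSet I in proj₁ (f 0F) ≢ proj₁ (f 1F)
  independent⇒differentBags I same = indep 0F 1F (inj₁ (same , (λ ()) ∘ inj))
    where open IndepSet I

corollary3p2 : ∀ {n : ℕ} (F : SimpleGraph n) → IsTarget F →
    (c : Fin n → ℕ) →
    Connected (Inflation (toGraph (complement F)) c) →
    IndependenceNumber2 (Inflation (toGraph (complement F)) c) →
    HasNonEmptyConnectedDominatingMatching (Inflation (toGraph (complement F)) c)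
corollary3p2 F target c conn (independentPair , _) =
  connectedDominatingMatching (isTarget⇒girth≥5 target) conn (f 0F) (f 1F)
    (independent⇒differentBags independentPair)
  where
  open InflatedComplement F c
  open IndepSet independentPair using (f)
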